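{- Let $H$ be a digraph with $k$ arcs and $\min_x(d^+(x)+d^-(x))\geq 1$, and suppose $1/C\ll\varepsilon'\ll\varepsilon$. Let $D$ be a digraph of order $n\geq Ck$ with $\delta^0(D)\geq n/2+k$. If $D$ satisfies the extremal condition (EC) with parameter $\varepsilon'$, then $D$ belongs to Extremal Case 1 (EC1) with parameter $\varepsilon$.
   Context: $x\ll y$ means $x$ is chosen sufficiently small relative to $y$. $\delta^0(D)=\min\{\delta^+(D),\delta^-(D)\}$. $e^+(X,Y)$ is the number of arcs from $X$ to $Y$, and $e(X)$ is the number of arcs of $D[X]$. (EC) with parameter $\varepsilon'$: there exist two (not necessarily disjoint) vertex sets $U_1,U_2$ of $D$ with $|U_i|\geq(1/2-\varepsilon')n$ for $i=1,2$ and $e^+(U_1,U_2)\leq(\varepsilon' n)^2$. (EC1) with parameter $\varepsilon$: $V(D)$ can be partitioned into four disjoint sets $W_1,W_2,W_3,W_4$ with $|W_1|=|W_3|\pm\varepsilon n$ and $|W_2|=|W_4|\pm\varepsilon n$ such that (A) $e^+(W_i,W_{i+1})\geq|W_i||W_{i+1}|-\varepsilon n^2$ for each $i\in[4]$, where $W_5=W_1$; (B) $e(W_i)\geq|W_i|^2-\varepsilon n^2$ for each $i\in\{1,3\}$; (C) $e^+(W_i,W_{i+2})\geq|W_i||W_{i+2}|-\varepsilon n^2$ for each $i\in\{2,4\}$, where $W_6=W_2$. Here $a\pm b$ denotes an unspecified number in $[a-b,a+b]$. -}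

module Defs where

open import Data.Bool using (Bool; true; false; _∧_; if_then_else_)
open import Data.Nat using (ℕ; zero; suc; _+_)
import Data.Nat
open import Data.Fin using (Fin; zero; suc)
open import Data.Integer using (+_)
open import Data.Rational using (ℚ; _/_; _≤_; _≥_; _<_; _-_; _*_; ½; ∣_∣; 0ℚ)
  renaming (_+_ to _+ℚ_)
open import Data.Product using (_×_; Σ; ∃)
open import Relation.Binary.PropositionalEquality using (_≡_)

⟦_⟧ : ℕ → ℚ
⟦ n ⟧ = + n / 1

count : ∀ {n} → (Fin n → Bool) → ℕ
count {zero}  p = 0
count {suc n} p = (if p zero then 1 else 0) + count (λ i → p (suc i))

sumF : ∀ {m} → (Fin m → ℕ) → ℕ
sumF {zero}  f = 0
sumF {suc m} f = f zero + sumF (λ i → f (suc i))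

-- A (simple) digraph: finite vertex set Fin order, arc relation, no loops.
-- Between two distinct vertices there is at most one arc in each direction
-- (both directions allowed).
record Digraph : Set where
  field
    order    : ℕ
    arc      : Fin order → Fin order → Bool
    loopless : ∀ x → arc x x ≡ false
open Digraph public

VSet : Digraph → Set
VSet D = Fin (order D) → Bool

size : (D : Digraph) → VSet D → ℕ
size D X = count X

arcs : Digraph → ℕ
arcs D = sumF (λ x → count (λ y → arc D x y))

outdeg : (D : Digraph) → Fin (order D) → ℕ
outdeg D x = count (λ y → arc D x y)

indeg : (D : Digraph) → Fin (order D) → ℕ
indeg D y = count (λ x → arc D x y)

e⁺ : (D : Digraph) → VSet D → VSet D → ℕ
e⁺ D X Y = sumF (λ x → count (λ y → X x ∧ Y y ∧ arc D x y))

eIn : (D : Digraph) → VSet D → ℕ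
eIn D X = e⁺ D X X

-- min_x (d⁺(x) + d⁻(x)) ≥ 1 (H has at least one vertex, so the minimum exists)
NoIsolated : Digraph → Set
NoIsolated H = (0 Data.Nat.< order H) × (∀ x → 1 Data.Nat.≤ outdeg H x + indeg H x)

δ⁰≥ : (D : Digraph) → ℚ → Set
δ⁰≥ D r = ∀ x → (r ≤ ⟦ outdeg D x ⟧) × (r ≤ ⟦ indeg D x ⟧)

EC : (D : Digraph) → ℚ → Set
EC D ε' = Σ (VSet D) λ U₁ → Σ (VSet D) λ U₂ →
    ((½ - ε') * ⟦ n ⟧ ≤ ⟦ size D U₁ ⟧)
  × ((½ - ε') * ⟦ n ⟧ ≤ ⟦ size D U₂ ⟧)
  × (⟦ e⁺ D U₁ U₂ ⟧ ≤ (ε' * ⟦ n ⟧) * (ε' * ⟦ n ⟧))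
  where n = order D

_≈_±_ : ℚ → ℚ → ℚ → Set
a ≈ b ± c = ∣ a - b ∣ ≤ c

-- (EC1) with parameter ε: a partition of V(D) into W₁,W₂,W₃,W₄ given by
-- a labelling  part : V(D) → Fin 4  (label 0,1,2,3 ↦ W₁,W₂,W₃,W₄)
EC1 : (D : Digraph) → ℚ → Set
EC1 D ε = Σ (Fin n → Fin 4) λ part → Conds (W part)
  where
    n = order D
    open import Data.Fin using (_≟_)
    open import Relation.Nullary.Decidable using (⌊_⌋)
    W : (Fin n → Fin 4) → Fin 4 → VSet D
    W part i x = ⌊ part x ≟ i ⌋
    N = ⟦ n ⟧
    ∣_∣ᵥ : VSet D → ℚ
    ∣ X ∣ᵥ = ⟦ size D X ⟧
    dense : VSet D → VSet D → Set
    dense X Y = ∣ X ∣ᵥ * ∣ Y ∣ᵥ - ε * (N * N) ≤ ⟦ e⁺ D X Y ⟧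
    Conds : (Fin 4 → VSet D) → Set
    Conds w =
        (∣ W₁ ∣ᵥ ≈ ∣ W₃ ∣ᵥ ± (ε * N))
      × (∣ W₂ ∣ᵥ ≈ ∣ W₄ ∣ᵥ ± (ε * N))
      × dense W₁ W₂ × dense W₂ W₃ × dense W₃ W₄ × dense W₄ W₁
      × (∣ W₁ ∣ᵥ * ∣ W₁ ∣ᵥ - ε * (N * N) ≤ ⟦ eIn D W₁ ⟧)
      × (∣ W₃ ∣ᵥ * ∣ W₃ ∣ᵥ - ε * (N * N) ≤ ⟦ eIn D W₃ ⟧)
      × dense W₂ W₄ × dense W₄ W₂
      where
        W₁ = w zero
        W₂ = w (suc zero)
        W₃ = w (suc (suc zero))
        W₄ = w (suc (suc (suc zero)))

-- The parts are W₁ = U₁ ∖ U₂, W₂ = V ∖ (U₁ ∪ U₂), W₃ = U₂ ∖ U₁ and W₄ = U₁ ∩ U₂.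
-- Summing out-degrees over U₁ and splitting each out-neighbourhood along U₂ gives
--   |U₁| n/2 + (non-arcs from U₁ to V ∖ U₂) ≤ e⁺(U₁, U₂) + |U₁| |V ∖ U₂| ≤ (ε′n)² + |U₁| |V ∖ U₂|.
-- Since |U₁| ≥ n/4 and |V ∖ U₂| ≤ (1/2 + ε′) n, this forces |U₂| ≤ (1/2 + O(ε′)) n and only
-- O(ε′n²) non-arcs from U₁ to V ∖ U₂. The same argument for in-degrees (in the reverse digraph)
-- bounds |U₁| from above and the non-arcs from V ∖ U₁ to U₂. Now all four parts have the right
-- sizes, and every pair EC1 asks to be dense lies inside U₁ × (V ∖ U₂) or (V ∖ U₁) × U₂.
-- The counting is done in ℕ with ε′ replaced by 1/m, where εm ≥ 2.

module Submission where

open import Data.Nat using (ℕ)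
open import Defs

module Counting where

  open import Data.Bool using (Bool; true; false; _∧_; not; if_then_else_; T)
  open import Data.Bool.Properties using (T-∧)
  open import Data.Empty using (⊥-elim)
  open import Data.Fin using (Fin; zero; suc)
  open import Data.Nat using (ℕ; zero; suc; _+_; _*_; _≤_; z≤n; s≤s)
  open import Data.Nat.Properties
  open import Data.Product using (map)
  open import Data.Unit using (tt)
  open import Function using (_∘_; Equivalence)
  open import Relation.Binary.PropositionalEquality
  open import Algebra.Properties.CommutativeMonoid.Sum +-0-commutativeMonoid
    using (sum; ∑-distrib-+; ∑-comm)
  open import Algebra.Properties.Semiring.Sum +-*-semiring using (*-distribˡ-sum)
  open ≡-Reasoning

  private variable
    m n : ℕ
    p q : Fin n → Bool
    f g : Fin n → ℕ

  count-cong : (∀ i → p i ≡ q i) → count p ≡ count q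
  count-cong {zero}  _  = refl
  count-cong {suc n} eq rewrite eq zero = cong (_ +_) (count-cong (eq ∘ suc))

  count-false : count {n} (λ _ → false) ≡ 0
  count-false {zero}  = refl
  count-false {suc n} = count-false {n}

  count-≤ : (p : Fin n → Bool) → count p ≤ n
  count-≤ {zero}  p = z≤n
  count-≤ {suc n} p with p zero
  ... | true  = s≤s (count-≤ (p ∘ suc))
  ... | false = m≤n⇒m≤1+n (count-≤ (p ∘ suc))

  count-mono : (∀ i → T (p i) → T (q i)) → count p ≤ count q
  count-mono {zero}          _   = z≤n
  count-mono {suc n} {p} {q} p⊆q with p zero | q zero | p⊆q zero
  ... | true  | true  | _   = s≤s (count-mono (p⊆q ∘ suc))
  ... | true  | false | 0∉q = ⊥-elim (0∉q tt)
  ... | false | true  | _   = m≤n⇒m≤1+n (count-mono (p⊆q ∘ suc))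
  ... | false | false | _   = count-mono (p⊆q ∘ suc)

  count-split : (p q : Fin n → Bool) →
                count p ≡ count (λ i → p i ∧ q i) + count (λ i → p i ∧ not (q i))
  count-split {zero}  p q = refl
  count-split {suc n} p q with p zero | q zero | count-split (p ∘ suc) (q ∘ suc)
  ... | true  | true  | ih = cong suc ih
  ... | true  | false | ih = trans (cong suc ih) (sym (+-suc _ _))
  ... | false | _     | ih = ih

  count-complement : (p : Fin n → Bool) → count p + count (λ i → not (p i)) ≡ n
  count-complement {zero}  p = refl
  count-complement {suc n} p with p zero
  ... | true  = cong suc (count-complement (p ∘ suc))
  ... | false = trans (+-suc _ _) (cong suc (count-complement (p ∘ suc)))

  ∧-mono-T : ∀ {a b c d} → (T a → T c) → (T b → T d) → T (a ∧ b) → T (c ∧ d)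
  ∧-mono-T f g = Equivalence.from T-∧ ∘ map f g ∘ Equivalence.to T-∧

  sumF≡sum : (f : Fin n → ℕ) → sumF f ≡ sum f
  sumF≡sum {zero}  f = refl
  sumF≡sum {suc n} f = cong (f zero +_) (sumF≡sum (f ∘ suc))

  sumF-cong : (∀ i → f i ≡ g i) → sumF f ≡ sumF g
  sumF-cong {zero}  _  = refl
  sumF-cong {suc n} eq = cong₂ _+_ (eq zero) (sumF-cong (eq ∘ suc))

  sumF-mono : (∀ i → f i ≤ g i) → sumF f ≤ sumF g
  sumF-mono {zero}  _   = z≤n
  sumF-mono {suc n} f≤g = +-mono-≤ (f≤g zero) (sumF-mono (f≤g ∘ suc))

  sumF-distrib-+ : (f g : Fin n → ℕ) → sumF (λ i → f i + g i) ≡ sumF f + sumF g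
  sumF-distrib-+ f g = begin
    sumF (λ i → f i + g i) ≡⟨ sumF≡sum (λ i → f i + g i) ⟩
    sum (λ i → f i + g i)  ≡⟨ ∑-distrib-+ f g ⟩
    sum f + sum g          ≡⟨ sym (cong₂ _+_ (sumF≡sum f) (sumF≡sum g)) ⟩
    sumF f + sumF g        ∎

  sumF-distribˡ-* : (c : ℕ) (f : Fin n → ℕ) → sumF (λ i → c * f i) ≡ c * sumF f
  sumF-distribˡ-* c f = begin
    sumF (λ i → c * f i) ≡⟨ sumF≡sum (λ i → c * f i) ⟩
    sum (λ i → c * f i)  ≡⟨ sym (*-distribˡ-sum c f) ⟩
    c * sum f            ≡⟨ cong (c *_) (sym (sumF≡sum f)) ⟩
    c * sumF f           ∎

  sumF-comm : (h : Fin m → Fin n → ℕ) → sumF (λ i → sumF (h i)) ≡ sumF (λ j → sumF (λ i → h i j))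
  sumF-comm h = begin
    sumF (λ i → sumF (h i))         ≡⟨ sumF-cong (λ i → sumF≡sum (h i)) ⟩
    sumF (λ i → sum (h i))          ≡⟨ sumF≡sum (λ i → sum (h i)) ⟩
    sum (λ i → sum (h i))           ≡⟨ ∑-comm h ⟩
    sum (λ j → sum (λ i → h i j))   ≡⟨ sym (sumF≡sum (λ j → sum (λ i → h i j))) ⟩
    sumF (λ j → sum (λ i → h i j))  ≡⟨ sumF-cong (λ j → sym (sumF≡sum (λ i → h i j))) ⟩
    sumF (λ j → sumF (λ i → h i j)) ∎

  sumF-if : (p : Fin n → Bool) (c : ℕ) → sumF (λ i → if p i then c else 0) ≡ count p * c
  sumF-if {zero}  p c = refl
  sumF-if {suc n} p c with p zero
  ... | true  = cong (c +_) (sumF-if (p ∘ suc) c)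
  ... | false = sumF-if (p ∘ suc) c

  count≡sumF : (p : Fin n → Bool) → count p ≡ sumF (λ i → if p i then 1 else 0)
  count≡sumF {zero}  p = refl
  count≡sumF {suc n} p = cong ((if p zero then 1 else 0) +_) (count≡sumF (p ∘ suc))

  count-*-≤-sumF : (∀ i → T (p i) → m ≤ f i) → count p * m ≤ sumF f
  count-*-≤-sumF {zero}          _   = z≤n
  count-*-≤-sumF {suc n} {p} {m} {f} bound with p zero | bound zero
  ... | true  | m≤f₀ = +-mono-≤ (m≤f₀ tt) (count-*-≤-sumF (bound ∘ suc))
  ... | false | _    = m≤n⇒m≤o+n (f zero) (count-*-≤-sumF (bound ∘ suc))

module PairCounting where

  open Counting
  open import Algebra.Bundles using (CommutativeMonoid)
  open import Data.Bool using (Bool; true; false; _∧_; not; if_then_else_; T)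
  open import Data.Bool.Properties using (∧-comm; ∧-commutativeMonoid)
  open import Algebra.Properties.CommutativeSemigroup
    (CommutativeMonoid.commutativeSemigroup ∧-commutativeMonoid) using (x∙yz≈y∙xz)
  open import Data.Fin using (Fin)
  open import Data.Nat using (ℕ; _+_; _*_; _≤_)
  open import Data.Nat.Properties using (≤-trans; ≤-reflexive)
  open import Function using (id)
  open import Relation.Binary.PropositionalEquality

  private variable
    n : ℕ

  pairs : (P Q : Fin n → Bool) (r : Fin n → Fin n → Bool) → ℕ
  pairs P Q r = sumF (λ x → count (λ y → P x ∧ Q y ∧ r x y))

  pairs-complement : (P Q : Fin n → Bool) (r : Fin n → Fin n → Bool) →
                     pairs P Q r + pairs P Q (λ x y → not (r x y)) ≡ count P * count Q
  pairs-complement {n} P Q r = begin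
    pairs P Q r + pairs P Q (λ x y → not (r x y))
      ≡⟨ sumF-distrib-+ (λ x → count (λ y → P x ∧ Q y ∧ r x y))
                        (λ x → count (λ y → P x ∧ Q y ∧ not (r x y))) ⟨
    sumF (λ x → count (λ y → P x ∧ Q y ∧ r x y) + count (λ y → P x ∧ Q y ∧ not (r x y)))
      ≡⟨ sumF-cong row ⟩
    sumF (λ x → if P x then count Q else 0)
      ≡⟨ sumF-if P (count Q) ⟩
    count P * count Q ∎
    where
    open ≡-Reasoning
    row : ∀ x → count (λ y → P x ∧ Q y ∧ r x y) + count (λ y → P x ∧ Q y ∧ not (r x y))
              ≡ (if P x then count Q else 0)
    row x with P x
    ... | true  = sym (count-split Q (r x))
    ... | false = cong₂ _+_ (count-false {n}) (count-false {n})

  pairs-split : (P Q : Fin n → Bool) (r : Fin n → Fin n → Bool) →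
                pairs P Q r + pairs P (λ y → not (Q y)) r ≡ pairs P (λ _ → true) r
  pairs-split {n} P Q r =
    trans (sym (sumF-distrib-+ (λ x → count (λ y → P x ∧ Q y ∧ r x y))
                               (λ x → count (λ y → P x ∧ not (Q y) ∧ r x y))))
          (sumF-cong row)
    where
    row : ∀ x → count (λ y → P x ∧ Q y ∧ r x y) + count (λ y → P x ∧ not (Q y) ∧ r x y)
              ≡ count (λ y → P x ∧ r x y)
    row x with P x
    ... | true  = sym (trans (count-split (r x) Q)
                      (cong₂ _+_ (count-cong (λ y → ∧-comm (r x y) (Q y)))
                                 (count-cong (λ y → ∧-comm (r x y) (not (Q y))))))
    ... | false = trans (cong₂ _+_ (count-false {n}) (count-false {n})) (sym (count-false {n}))

  pairs-mono : {P Q P′ Q′ : Fin n → Bool} (r : Fin n → Fin n → Bool) →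
               (∀ x → T (P x) → T (P′ x)) → (∀ y → T (Q y) → T (Q′ y)) →
               pairs P Q r ≤ pairs P′ Q′ r
  pairs-mono r P⊆P′ Q⊆Q′ =
    sumF-mono (λ x → count-mono (λ y → ∧-mono-T (P⊆P′ x) (∧-mono-T (Q⊆Q′ y) id)))

  pairs-transpose : (P Q : Fin n → Bool) (r : Fin n → Fin n → Bool) →
                    pairs P Q r ≡ pairs Q P (λ y x → r x y)
  pairs-transpose P Q r = begin
    sumF (λ x → count (λ y → P x ∧ Q y ∧ r x y))
      ≡⟨ sumF-cong (λ x → count≡sumF (λ y → P x ∧ Q y ∧ r x y)) ⟩
    sumF (λ x → sumF (λ y → if P x ∧ Q y ∧ r x y then 1 else 0))
      ≡⟨ sumF-comm (λ x y → if P x ∧ Q y ∧ r x y then 1 else 0) ⟩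
    sumF (λ y → sumF (λ x → if P x ∧ Q y ∧ r x y then 1 else 0))
      ≡⟨ sumF-cong (λ y → sumF-cong (λ x → cong (if_then 1 else 0) (x∙yz≈y∙xz (P x) (Q y) (r x y)))) ⟩
    sumF (λ y → sumF (λ x → if Q y ∧ P x ∧ r x y then 1 else 0))
      ≡⟨ sumF-cong (λ y → count≡sumF (λ x → Q y ∧ P x ∧ r x y)) ⟨
    sumF (λ y → count (λ x → Q y ∧ P x ∧ r x y)) ∎
    where open ≡-Reasoning

  pairs-≥-rows : {a : ℕ} (c : ℕ) (P : Fin n → Bool) (r : Fin n → Fin n → Bool) →
                 (∀ x → T (P x) → a ≤ c * count (r x)) →
                 count P * a ≤ c * pairs P (λ _ → true) r
  pairs-≥-rows {n} {a} c P r bound =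
    ≤-trans (count-*-≤-sumF row) (≤-reflexive (sumF-distribˡ-* c (λ x → count (λ y → P x ∧ r x y))))
    where
    row : ∀ x → T (P x) → a ≤ c * count (λ y → P x ∧ r x y)
    row x with P x | bound x
    ... | true  | b = b
    ... | false | _ = λ ()

module ArcCounting where

  open Counting
  open PairCounting
  open import Data.Bool using (true; not; T)
  open import Data.Nat using (ℕ; _+_; _*_; _≤_)
  open import Data.Nat.Properties using (+-monoˡ-≤; +-monoʳ-≤; module ≤-Reasoning)
  open import Data.Nat.Tactic.RingSolver using (solve-∀)
  open import Function using (_∘_)
  open import Relation.Binary.PropositionalEquality

  reverse : Digraph → Digraph
  reverse D = record { order = order D ; arc = λ x y → arc D y x ; loopless = loopless D }

  nonArcs : (D : Digraph) → VSet D → VSet D → ℕ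
  nonArcs D P Q = pairs P Q (λ x y → not (arc D x y))

  e⁺-reverse : (D : Digraph) (P Q : VSet D) → e⁺ (reverse D) P Q ≡ e⁺ D Q P
  e⁺-reverse D P Q = pairs-transpose P Q (λ x y → arc D y x)

  nonArcs-reverse : (D : Digraph) (P Q : VSet D) → nonArcs (reverse D) P Q ≡ nonArcs D Q P
  nonArcs-reverse D P Q = pairs-transpose P Q (λ x y → not (arc D y x))

  e⁺+nonArcs : (D : Digraph) (P Q : VSet D) → e⁺ D P Q + nonArcs D P Q ≡ count P * count Q
  e⁺+nonArcs D P Q = pairs-complement P Q (arc D)

  count*count≤e⁺+nonArcs : (D : Digraph) {P Q U V : VSet D} →
    (∀ x → T (P x) → T (U x)) → (∀ y → T (Q y) → T (V y)) →
    count P * count Q ≤ e⁺ D P Q + nonArcs D U V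
  count*count≤e⁺+nonArcs D {P} {Q} {U} {V} P⊆U Q⊆V =
    subst (_≤ e⁺ D P Q + nonArcs D U V) (e⁺+nonArcs D P Q)
          (+-monoʳ-≤ (e⁺ D P Q) (pairs-mono {P = P} {Q} {U} {V} (λ x y → not (arc D x y)) P⊆U Q⊆V))

  half-outdegree⇒nonArcs-bound : (D : Digraph) (X Y : VSet D) →
    (∀ x → order D ≤ 2 * outdeg D x) →
    count X * order D + 2 * nonArcs D X (not ∘ Y) ≤ 2 * e⁺ D X Y + 2 * (count X * count (not ∘ Y))
  half-outdegree⇒nonArcs-bound D X Y deg = begin
    count X * order D + 2 * M
      ≤⟨ +-monoˡ-≤ (2 * M) (pairs-≥-rows 2 X (arc D) (λ x _ → deg x)) ⟩
    2 * pairs X (λ _ → true) (arc D) + 2 * M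
      ≡⟨ cong (λ t → 2 * t + 2 * M) (pairs-split X Y (arc D)) ⟨
    2 * (e⁺ D X Y + e⁺ D X (not ∘ Y)) + 2 * M
      ≡⟨ regroup (e⁺ D X Y) (e⁺ D X (not ∘ Y)) M ⟩
    2 * e⁺ D X Y + 2 * (e⁺ D X (not ∘ Y) + M)
      ≡⟨ cong (λ t → 2 * e⁺ D X Y + 2 * t) (e⁺+nonArcs D X (not ∘ Y)) ⟩
    2 * e⁺ D X Y + 2 * (count X * count (not ∘ Y)) ∎
    where
    open ≤-Reasoning
    M : ℕ
    M = nonArcs D X (not ∘ Y)
    regroup : ∀ a b c → 2 * (a + b) + 2 * c ≡ 2 * a + 2 * (b + c)
    regroup = solve-∀

module NearHalf (m : ℕ) where

  open import Data.Nat using (ℕ; zero; suc; _+_; _*_; _≤_; z≤n; s≤s; >-nonZero)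
  open import Data.Nat.Properties
  open import Data.Nat.Tactic.RingSolver using (solve)
  open import Data.List using (_∷_; [])
  open import Relation.Binary.PropositionalEquality

  private variable
    n u c x E M : ℕ

  -- u ≥ (1/2 − 1/m) n and u ≤ (1/2 + 1/m) n, with the denominators cleared.
  AtLeastHalf AtMostHalf : (n u : ℕ) → Set
  AtLeastHalf n u = m * n ≤ 2 * m * u + 2 * n
  AtMostHalf  n u = 2 * m * u ≤ m * n + 2 * n

  -- x n / 2 + M ≤ (n / m)² + x c, with the denominators cleared; used with x = |X|,
  -- c = |V ∖ Y| and M the number of non-arcs from X to V ∖ Y.
  DegreeBound : (n x c M : ℕ) → Set
  DegreeBound n x c M = m * m * (x * n) + 2 * (m * m * M) ≤ 2 * (n * n) + m * x * (2 * m * c)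

  atMostHalf-complement : u + c ≡ n → AtLeastHalf n c → AtMostHalf n u
  atMostHalf-complement {u} {c} {n} u+c≡n c≥ = +-cancelˡ-≤ (m * n) _ _ (begin
    m * n + 2 * m * u       ≤⟨ +-monoˡ-≤ _ c≥ ⟩
    2 * m * c + 2 * n + 2 * m * u ≡⟨ solve (m ∷ c ∷ n ∷ u ∷ []) ⟩
    2 * m * (u + c) + 2 * n ≡⟨ cong (λ t → 2 * m * t + 2 * n) u+c≡n ⟩
    2 * m * n + 2 * n       ≡⟨ solve (m ∷ n ∷ []) ⟩
    m * n + (m * n + 2 * n) ∎)
    where open ≤-Reasoning

  atLeastHalf-complement : u + c ≡ n → AtMostHalf n c → AtLeastHalf n u
  atLeastHalf-complement {u} {c} {n} u+c≡n c≤ = +-cancelˡ-≤ (m * n) _ _ (begin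
    m * n + m * n           ≡⟨ solve (m ∷ n ∷ []) ⟩
    2 * m * n               ≡⟨ cong (2 * m *_) u+c≡n ⟨
    2 * m * (u + c)         ≡⟨ solve (m ∷ u ∷ c ∷ []) ⟩
    2 * m * u + 2 * m * c   ≤⟨ +-monoʳ-≤ _ c≤ ⟩
    2 * m * u + (m * n + 2 * n) ≡⟨ solve (m ∷ u ∷ n ∷ []) ⟩
    m * n + (2 * m * u + 2 * n) ∎)
    where open ≤-Reasoning

  atLeastHalf⇒≤m* : 4 ≤ m → AtLeastHalf n x → n ≤ m * x
  atLeastHalf⇒≤m* {n} {x} 4≤m x≥ = *-cancelˡ-≤ 2 (+-cancelʳ-≤ (2 * n) _ _ (begin
    2 * n + 2 * n   ≡⟨ solve (n ∷ []) ⟩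
    4 * n           ≤⟨ *-monoˡ-≤ n 4≤m ⟩
    m * n           ≤⟨ x≥ ⟩
    2 * m * x + 2 * n ≡⟨ cong (_+ 2 * n) (*-assoc 2 m x) ⟩
    2 * (m * x) + 2 * n ∎))
    where open ≤-Reasoning

  degreeBound : x * n + 2 * M ≤ 2 * E + 2 * (x * c) → m * m * E ≤ n * n → DegreeBound n x c M
  degreeBound {x} {n} {M} {E} {c} deg sparse = begin
    m * m * (x * n) + 2 * (m * m * M)  ≡⟨ solve (m ∷ x ∷ n ∷ M ∷ []) ⟩
    m * m * (x * n + 2 * M)            ≤⟨ *-monoʳ-≤ (m * m) deg ⟩
    m * m * (2 * E + 2 * (x * c))      ≡⟨ solve (m ∷ E ∷ x ∷ c ∷ []) ⟩
    2 * (m * m * E) + m * x * (2 * m * c) ≤⟨ +-monoˡ-≤ _ (*-monoʳ-≤ 2 sparse) ⟩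
    2 * (n * n) + m * x * (2 * m * c)  ∎
    where open ≤-Reasoning

  few-nonArcs : 1 ≤ m → x ≤ n → AtMostHalf n c → DegreeBound n x c M → m * M ≤ 2 * (n * n)
  few-nonArcs {x} {n} {c} {M} 1≤m x≤n c≤ bound =
    *-cancelˡ-≤ m {{>-nonZero 1≤m}} (begin
      m * (m * M)                ≡⟨ *-assoc m m M ⟨
      m * m * M                  ≤⟨ *-cancelˡ-≤ 2 (+-cancelˡ-≤ (m * m * (x * n)) _ _ doubled) ⟩
      n * n + m * (x * n)        ≤⟨ +-mono-≤ (m≤n*m (n * n) m {{>-nonZero 1≤m}})
                                             (*-monoʳ-≤ m (*-monoˡ-≤ n x≤n)) ⟩
      m * (n * n) + m * (n * n)  ≡⟨ solve (m ∷ n ∷ []) ⟩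
      m * (2 * (n * n))          ∎)
    where
    open ≤-Reasoning
    doubled : m * m * (x * n) + 2 * (m * m * M) ≤ m * m * (x * n) + 2 * (n * n + m * (x * n))
    doubled = begin
      m * m * (x * n) + 2 * (m * m * M)       ≤⟨ bound ⟩
      2 * (n * n) + m * x * (2 * m * c)       ≤⟨ +-monoʳ-≤ _ (*-monoʳ-≤ (m * x) c≤) ⟩
      2 * (n * n) + m * x * (m * n + 2 * n)   ≡⟨ solve (m ∷ x ∷ n ∷ []) ⟩
      m * m * (x * n) + 2 * (n * n + m * (x * n)) ∎

  atLeastHalf-from-degree : n ≤ m * x → DegreeBound n x c M → AtLeastHalf n c
  atLeastHalf-from-degree {n} {x} {c} {M} n≤mx bound = cancel n≤mx (begin
      m * x * (m * n)                    ≡⟨ solve (m ∷ x ∷ n ∷ []) ⟩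
      m * m * (x * n)                    ≤⟨ m≤m+n _ _ ⟩
      m * m * (x * n) + 2 * (m * m * M)  ≤⟨ bound ⟩
      2 * (n * n) + m * x * (2 * m * c)  ≡⟨ cong (_+ m * x * (2 * m * c)) (solve (n ∷ [])) ⟩
      n * (2 * n) + m * x * (2 * m * c)  ≤⟨ +-monoˡ-≤ _ (*-monoˡ-≤ (2 * n) n≤mx) ⟩
      m * x * (2 * n) + m * x * (2 * m * c) ≡⟨ solve (m ∷ x ∷ n ∷ c ∷ []) ⟩
      m * x * (2 * m * c + 2 * n)        ∎)
    where
    open ≤-Reasoning
    cancel : ∀ {k t b} → k ≤ t → t * (m * k) ≤ t * b → m * k ≤ b
    cancel {zero}          _   _ = ≤-trans (≤-reflexive (*-zeroʳ m)) z≤n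
    cancel {suc _} {t} k≤t le = *-cancelˡ-≤ t {{>-nonZero (≤-trans (s≤s z≤n) k≤t)}} le

  close-by-common-part : ∀ {a b s v} → s + a ≡ u → s + b ≡ v →
    AtMostHalf n u → AtLeastHalf n v → m * a ≤ m * b + 2 * n
  close-by-common-part {u} {n} {a} {b} {s} {v} s+a≡u s+b≡v u≤ v≥ =
    *-cancelˡ-≤ 2 (+-cancelʳ-≤ (2 * m * s) _ _ (begin
      2 * (m * a) + 2 * m * s          ≡⟨ solve (m ∷ a ∷ s ∷ []) ⟩
      2 * m * (s + a)                  ≡⟨ cong (2 * m *_) s+a≡u ⟩
      2 * m * u                        ≤⟨ u≤ ⟩
      m * n + 2 * n                    ≤⟨ +-monoˡ-≤ (2 * n) v≥ ⟩
      2 * m * v + 2 * n + 2 * n        ≡⟨ cong (λ t → 2 * m * t + 2 * n + 2 * n) s+b≡v ⟨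
      2 * m * (s + b) + 2 * n + 2 * n  ≡⟨ solve (m ∷ b ∷ s ∷ n ∷ []) ⟩
      2 * (m * b + 2 * n) + 2 * m * s  ∎))
    where open ≤-Reasoning

module NatEmbedding where

  open import Data.Nat as ℕ using (ℕ; z≤n; >-nonZero)
  open import Data.Nat.Coprimality using (1-coprimeTo) renaming (sym to coprime-sym)
  open import Data.Integer as ℤ using (+_; +≤+)
  import Data.Integer.Properties as ℤ
  open import Data.Integer.Tactic.RingSolver using (solve-∀)
  open import Data.Rational using (ℚ; 0ℚ; _≤_; _+_; _*_; toℚᵘ; Positive; nonNegative)
  import Data.Rational.Properties as ℚ
  import Data.Rational.Unnormalised as ℚᵘ
  import Data.Rational.Unnormalised.Properties as ℚᵘ
  open import Relation.Binary.PropositionalEquality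

  toℚᵘ-⟦⟧ : ∀ n → toℚᵘ ⟦ n ⟧ ≡ ℚᵘ.mkℚᵘ (+ n) 0
  toℚᵘ-⟦⟧ n = cong toℚᵘ (ℚ.normalize-coprime (coprime-sym (1-coprimeTo n)))

  ⟦⟧-homo-+ : ∀ a b → ⟦ a ℕ.+ b ⟧ ≡ ⟦ a ⟧ + ⟦ b ⟧
  ⟦⟧-homo-+ a b = ℚ.toℚᵘ-injective (ℚᵘ.≃-trans ≃-sum (ℚᵘ.≃-sym (ℚ.toℚᵘ-homo-+ ⟦ a ⟧ ⟦ b ⟧)))
    where
    ≃-sum : toℚᵘ ⟦ a ℕ.+ b ⟧ ℚᵘ.≃ toℚᵘ ⟦ a ⟧ ℚᵘ.+ toℚᵘ ⟦ b ⟧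
    ≃-sum rewrite toℚᵘ-⟦⟧ (a ℕ.+ b) | toℚᵘ-⟦⟧ a | toℚᵘ-⟦⟧ b =
      ℚᵘ.*≡* (trans (cong (ℤ._* + 1) (ℤ.pos-+ a b)) (identity (+ a) (+ b)))
      where
      identity : ∀ x y → (x ℤ.+ y) ℤ.* + 1 ≡ (x ℤ.* + 1 ℤ.+ y ℤ.* + 1) ℤ.* + 1
      identity = solve-∀

  ⟦⟧-homo-* : ∀ a b → ⟦ a ℕ.* b ⟧ ≡ ⟦ a ⟧ * ⟦ b ⟧
  ⟦⟧-homo-* a b = ℚ.toℚᵘ-injective (ℚᵘ.≃-trans ≃-product (ℚᵘ.≃-sym (ℚ.toℚᵘ-homo-* ⟦ a ⟧ ⟦ b ⟧)))
    where
    ≃-product : toℚᵘ ⟦ a ℕ.* b ⟧ ℚᵘ.≃ toℚᵘ ⟦ a ⟧ ℚᵘ.* toℚᵘ ⟦ b ⟧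
    ≃-product rewrite toℚᵘ-⟦⟧ (a ℕ.* b) | toℚᵘ-⟦⟧ a | toℚᵘ-⟦⟧ b =
      ℚᵘ.*≡* (cong (ℤ._* + 1) (ℤ.pos-* a b))

  ⟦⟧-mono-≤ : ∀ {a b} → a ℕ.≤ b → ⟦ a ⟧ ≤ ⟦ b ⟧
  ⟦⟧-mono-≤ {a} {b} a≤b = ℚ.toℚᵘ-cancel-≤ (subst₂ ℚᵘ._≤_ (sym (toℚᵘ-⟦⟧ a)) (sym (toℚᵘ-⟦⟧ b))
    (ℚᵘ.*≤* (subst₂ ℤ._≤_ (sym (ℤ.*-identityʳ (+ a))) (sym (ℤ.*-identityʳ (+ b))) (+≤+ a≤b))))

  ⟦⟧-cancel-≤ : ∀ {a b} → ⟦ a ⟧ ≤ ⟦ b ⟧ → a ℕ.≤ b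
  ⟦⟧-cancel-≤ {a} {b} le = ℤ.drop‿+≤+ (subst₂ ℤ._≤_ (ℤ.*-identityʳ (+ a)) (ℤ.*-identityʳ (+ b))
    (ℚᵘ.drop-*≤* (subst₂ ℚᵘ._≤_ (toℚᵘ-⟦⟧ a) (toℚᵘ-⟦⟧ b) (ℚ.toℚᵘ-mono-≤ le))))

  ⟦⟧-nonNeg : ∀ n → 0ℚ ≤ ⟦ n ⟧
  ⟦⟧-nonNeg n = ⟦⟧-mono-≤ {0} {n} z≤n

  ⟦⟧-*-monoˡ-≤ : ∀ n {p q} → p ≤ q → ⟦ n ⟧ * p ≤ ⟦ n ⟧ * q
  ⟦⟧-*-monoˡ-≤ n = ℚ.*-monoˡ-≤-nonNeg ⟦ n ⟧ {{nonNegative (⟦⟧-nonNeg n)}}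

  ⟦⟧-*-monoʳ-≤ : ∀ n {p q} → p ≤ q → p * ⟦ n ⟧ ≤ q * ⟦ n ⟧
  ⟦⟧-*-monoʳ-≤ n = ℚ.*-monoʳ-≤-nonNeg ⟦ n ⟧ {{nonNegative (⟦⟧-nonNeg n)}}

  ⟦⟧-positive : ∀ {n} → 1 ℕ.≤ n → Positive ⟦ n ⟧
  ⟦⟧-positive {n} 1≤n = ℚ.normalize-pos n 1 {{_}} {{>-nonZero 1≤n}}

module RationalOrder where

  open import Data.Rational using (ℚ; 0ℚ; _≤_; _+_; _*_; _-_; -_; ∣_∣; nonNegative)
  open import Data.Rational.Properties
  open import Data.Rational.Solver using (module +-*-Solver)
  open import Data.Sum using (inj₁; inj₂)
  open import Relation.Binary.PropositionalEquality using (_≡_; refl; sym; subst)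
  open +-*-Solver using (solve; _:=_; _:+_; _:-_; :-_)
  open ≤-Reasoning

  ≤-+-nonNeg : ∀ {p q} → 0ℚ ≤ q → p ≤ p + q
  ≤-+-nonNeg {p} {q} 0≤q = begin
    p       ≡⟨ +-identityʳ p ⟨
    p + 0ℚ  ≤⟨ +-monoʳ-≤ p 0≤q ⟩
    p + q   ∎

  ≤-+⇒-≤ : ∀ {p q r} → p ≤ q + r → p - r ≤ q
  ≤-+⇒-≤ {p} {q} {r} p≤q+r = begin
    p - r        ≤⟨ +-monoˡ-≤ (- r) p≤q+r ⟩
    q + r - r    ≡⟨ solve 2 (λ q r → q :+ r :- r := q) refl q r ⟩
    q            ∎

  ∣-∣-≤ : ∀ {p q r} → p ≤ q + r → q ≤ p + r → ∣ p - q ∣ ≤ r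
  ∣-∣-≤ {p} {q} {r} p≤q+r q≤p+r with ∣p∣≡p∨∣p∣≡-p (p - q)
  ... | inj₁ ∣p-q∣≡p-q = subst (_≤ r) (sym ∣p-q∣≡p-q) (≤-+⇒-≤ (subst (p ≤_) (+-comm q r) p≤q+r))
  ... | inj₂ ∣p-q∣≡q-p = subst (_≤ r) (sym ∣p-q∣≡q-p) (begin
    - (p - q)  ≡⟨ solve 2 (λ p q → :- (p :- q) := q :- p) refl p q ⟩
    q - p      ≤⟨ ≤-+⇒-≤ (subst (q ≤_) (+-comm p r) q≤p+r) ⟩
    r          ∎)

  square-mono-≤ : ∀ {p q} → 0ℚ ≤ p → p ≤ q → p * p ≤ q * q
  square-mono-≤ {p} {q} 0≤p p≤q =
    ≤-trans (*-monoˡ-≤-nonNeg p {{nonNegative 0≤p}} p≤q)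
              (*-monoʳ-≤-nonNeg q {{nonNegative (≤-trans 0≤p p≤q)}} p≤q)

module RationalBridge where

  open NearHalf
  open NatEmbedding
  open RationalOrder
  open import Data.Nat as ℕ using (ℕ; suc; z≤n; s≤s)
  import Data.Nat.Properties as ℕ
  open import Data.Integer as ℤ using (+≤+; +[1+_]; +0; -[1+_])
  open import Data.Rational as ℚ
    using (ℚ; mkℚ; 0ℚ; 1ℚ; ½; _≤_; _<_; _+_; _*_; _-_; ∣_∣; 1/_; toℚᵘ; NonZero; nonNegative)
  import Data.Rational.Properties as ℚ
  import Data.Rational.Unnormalised as ℚᵘ
  import Data.Rational.Unnormalised.Properties as ℚᵘ
  open import Data.Rational.Solver using (module +-*-Solver)
  open import Data.Product using (Σ; _×_; _,_)
  open import Relation.Binary.PropositionalEquality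
  open +-*-Solver using (solve; _:=_; _:+_; _:*_; _:-_; con)
  open ℚ.≤-Reasoning

  ½n+k≤d⇒n≤2d : ∀ n k d → ½ * ⟦ n ⟧ + ⟦ k ⟧ ≤ ⟦ d ⟧ → n ℕ.≤ 2 ℕ.* d
  ½n+k≤d⇒n≤2d n k d h = ⟦⟧-cancel-≤ (begin
    ⟦ n ⟧                ≡⟨ solve 1 (λ N → N := con ⟦ 2 ⟧ :* (con ½ :* N)) refl ⟦ n ⟧ ⟩
    ⟦ 2 ⟧ * (½ * ⟦ n ⟧)  ≤⟨ ⟦⟧-*-monoˡ-≤ 2 {½ * ⟦ n ⟧} (ℚ.≤-trans (≤-+-nonNeg (⟦⟧-nonNeg k)) h) ⟩
    ⟦ 2 ⟧ * ⟦ d ⟧        ≡⟨ ⟦⟧-homo-* 2 d ⟨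
    ⟦ 2 ℕ.* d ⟧          ∎)

  atLeastHalf-from-ℚ : ∀ m n u ε′ → ⟦ m ⟧ * ε′ ≤ 1ℚ → (½ - ε′) * ⟦ n ⟧ ≤ ⟦ u ⟧ → AtLeastHalf m n u
  atLeastHalf-from-ℚ m n u ε′ mε′≤1 u≥ = ⟦⟧-cancel-≤ (begin
    ⟦ m ℕ.* n ⟧
      ≡⟨ ⟦⟧-homo-* m n ⟩
    ⟦ m ⟧ * ⟦ n ⟧
      ≡⟨ solve 3 (λ M N e → M :* N := con ⟦ 2 ⟧ :* (M :* ((con ½ :- e) :* N)) :+ con ⟦ 2 ⟧ :* ((M :* e) :* N))
               refl ⟦ m ⟧ ⟦ n ⟧ ε′ ⟩
    ⟦ 2 ⟧ * (⟦ m ⟧ * ((½ - ε′) * ⟦ n ⟧)) + ⟦ 2 ⟧ * ((⟦ m ⟧ * ε′) * ⟦ n ⟧)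
      ≤⟨ ℚ.+-mono-≤ (⟦⟧-*-monoˡ-≤ 2 (⟦⟧-*-monoˡ-≤ m u≥)) (⟦⟧-*-monoˡ-≤ 2 (⟦⟧-*-monoʳ-≤ n mε′≤1)) ⟩
    ⟦ 2 ⟧ * (⟦ m ⟧ * ⟦ u ⟧) + ⟦ 2 ⟧ * (1ℚ * ⟦ n ⟧)
      ≡⟨ cong₂ _+_ (trans (⟦⟧-homo-* (2 ℕ.* m) u)
                          (trans (cong (_* ⟦ u ⟧) (⟦⟧-homo-* 2 m)) (ℚ.*-assoc ⟦ 2 ⟧ ⟦ m ⟧ ⟦ u ⟧)))
                   (trans (⟦⟧-homo-* 2 n) (cong (⟦ 2 ⟧ *_) (sym (ℚ.*-identityˡ ⟦ n ⟧)))) ⟨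
    ⟦ 2 ℕ.* m ℕ.* u ⟧ + ⟦ 2 ℕ.* n ⟧
      ≡⟨ ⟦⟧-homo-+ (2 ℕ.* m ℕ.* u) (2 ℕ.* n) ⟨
    ⟦ 2 ℕ.* m ℕ.* u ℕ.+ 2 ℕ.* n ⟧ ∎)

  sparse-from-ℚ : ∀ m n E ε′ → 0ℚ ≤ ε′ → ⟦ m ⟧ * ε′ ≤ 1ℚ →
    ⟦ E ⟧ ≤ (ε′ * ⟦ n ⟧) * (ε′ * ⟦ n ⟧) → m ℕ.* m ℕ.* E ℕ.≤ n ℕ.* n
  sparse-from-ℚ m n E ε′ 0≤ε′ mε′≤1 E≤ = ⟦⟧-cancel-≤ (begin
    ⟦ m ℕ.* m ℕ.* E ⟧
      ≡⟨ ⟦⟧-homo-* (m ℕ.* m) E ⟩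
    ⟦ m ℕ.* m ⟧ * ⟦ E ⟧
      ≤⟨ ⟦⟧-*-monoˡ-≤ (m ℕ.* m) E≤ ⟩
    ⟦ m ℕ.* m ⟧ * ((ε′ * ⟦ n ⟧) * (ε′ * ⟦ n ⟧))
      ≡⟨ cong (_* ((ε′ * ⟦ n ⟧) * (ε′ * ⟦ n ⟧))) (⟦⟧-homo-* m m) ⟩
    ⟦ m ⟧ * ⟦ m ⟧ * ((ε′ * ⟦ n ⟧) * (ε′ * ⟦ n ⟧))
      ≡⟨ solve 3 (λ M N e → M :* M :* ((e :* N) :* (e :* N)) := ((M :* e) :* N) :* ((M :* e) :* N))
               refl ⟦ m ⟧ ⟦ n ⟧ ε′ ⟩
    (⟦ m ⟧ * ε′ * ⟦ n ⟧) * (⟦ m ⟧ * ε′ * ⟦ n ⟧)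
      ≤⟨ square-mono-≤ 0≤mε′n mε′n≤n ⟩
    ⟦ n ⟧ * ⟦ n ⟧
      ≡⟨ ⟦⟧-homo-* n n ⟨
    ⟦ n ℕ.* n ⟧ ∎)
    where
    0≤mε′n : 0ℚ ≤ ⟦ m ⟧ * ε′ * ⟦ n ⟧
    0≤mε′n = ℚ.nonNegative⁻¹ _
      {{ℚ.nonNeg*nonNeg⇒nonNeg (⟦ m ⟧ * ε′)
          {{ℚ.nonNeg*nonNeg⇒nonNeg ⟦ m ⟧ {{nonNegative (⟦⟧-nonNeg m)}} ε′ {{nonNegative 0≤ε′}}}}
          ⟦ n ⟧ {{nonNegative (⟦⟧-nonNeg n)}}}}
    mε′n≤n : ⟦ m ⟧ * ε′ * ⟦ n ⟧ ≤ ⟦ n ⟧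
    mε′n≤n = ℚ.≤-trans (⟦⟧-*-monoʳ-≤ n mε′≤1) (ℚ.≤-reflexive (ℚ.*-identityˡ ⟦ n ⟧))

  ≤-+-scaled : ∀ m ε a b c → 1 ℕ.≤ m → ⟦ 2 ⟧ ≤ ε * ⟦ m ⟧ →
    m ℕ.* a ℕ.≤ m ℕ.* b ℕ.+ 2 ℕ.* c → ⟦ a ⟧ ≤ ⟦ b ⟧ + ε * ⟦ c ⟧
  ≤-+-scaled m ε a b c 1≤m 2≤εm ma≤ = ℚ.*-cancelˡ-≤-pos ⟦ m ⟧ {{⟦⟧-positive 1≤m}} (begin
    ⟦ m ⟧ * ⟦ a ⟧                  ≡⟨ ⟦⟧-homo-* m a ⟨
    ⟦ m ℕ.* a ⟧                    ≤⟨ ⟦⟧-mono-≤ ma≤ ⟩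
    ⟦ m ℕ.* b ℕ.+ 2 ℕ.* c ⟧        ≡⟨ trans (⟦⟧-homo-+ (m ℕ.* b) (2 ℕ.* c))
                                            (cong₂ _+_ (⟦⟧-homo-* m b) (⟦⟧-homo-* 2 c)) ⟩
    ⟦ m ⟧ * ⟦ b ⟧ + ⟦ 2 ⟧ * ⟦ c ⟧  ≤⟨ ℚ.+-monoʳ-≤ (⟦ m ⟧ * ⟦ b ⟧) (⟦⟧-*-monoʳ-≤ c 2≤εm) ⟩
    ⟦ m ⟧ * ⟦ b ⟧ + ε * ⟦ m ⟧ * ⟦ c ⟧ ≡⟨ solve 4 (λ M B C e → M :* B :+ e :* M :* C := M :* (B :+ e :* C))
                                             refl ⟦ m ⟧ ⟦ b ⟧ ⟦ c ⟧ ε ⟩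
    ⟦ m ⟧ * (⟦ b ⟧ + ε * ⟦ c ⟧)    ∎)

  close-to-ℚ : ∀ m ε n a b → 1 ℕ.≤ m → ⟦ 2 ⟧ ≤ ε * ⟦ m ⟧ →
    m ℕ.* a ℕ.≤ m ℕ.* b ℕ.+ 2 ℕ.* n → m ℕ.* b ℕ.≤ m ℕ.* a ℕ.+ 2 ℕ.* n →
    ∣ ⟦ a ⟧ - ⟦ b ⟧ ∣ ≤ ε * ⟦ n ⟧
  close-to-ℚ m ε n a b 1≤m 2≤εm a≤ b≤ =
    ∣-∣-≤ (≤-+-scaled m ε a b n 1≤m 2≤εm a≤) (≤-+-scaled m ε b a n 1≤m 2≤εm b≤)

  dense-to-ℚ : ∀ m ε n p q e {M} → 1 ℕ.≤ m → ⟦ 2 ⟧ ≤ ε * ⟦ m ⟧ →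
    p ℕ.* q ℕ.≤ e ℕ.+ M → m ℕ.* M ℕ.≤ 2 ℕ.* (n ℕ.* n) →
    ⟦ p ⟧ * ⟦ q ⟧ - ε * (⟦ n ⟧ * ⟦ n ⟧) ≤ ⟦ e ⟧
  dense-to-ℚ m ε n p q e {M} 1≤m 2≤εm pq≤ mM≤ =
    ≤-+⇒-≤ (subst₂ (λ s t → s ≤ ⟦ e ⟧ + ε * t) (⟦⟧-homo-* p q) (⟦⟧-homo-* n n)
                   (≤-+-scaled m ε (p ℕ.* q) e (n ℕ.* n) 1≤m 2≤εm
                               (ℕ.≤-trans (ℕ.*-monoʳ-≤ m pq≤) m[e+M]≤)))
    where
    m[e+M]≤ : m ℕ.* (e ℕ.+ M) ℕ.≤ m ℕ.* e ℕ.+ 2 ℕ.* (n ℕ.* n)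
    m[e+M]≤ = ℕ.≤-trans (ℕ.≤-reflexive (ℕ.*-distribˡ-+ m e M)) (ℕ.+-monoʳ-≤ (m ℕ.* e) mM≤)

  scale-for : ∀ ε → 0ℚ < ε → Σ ℕ λ m → 4 ℕ.≤ m × ⟦ 2 ⟧ ≤ ε * ⟦ m ⟧
  scale-for ε@(mkℚ +[1+ p ] d _) _ =
    4 ℕ.* suc d , ℕ.m≤m*n 4 (suc d) ,
    ℚ.toℚᵘ-cancel-≤ (ℚᵘ.≤-respʳ-≃ (ℚᵘ.≃-sym (ℚ.toℚᵘ-homo-* ε ⟦ 4 ℕ.* suc d ⟧)) ≤ᵘ)
    where
    ≤ᵘ : toℚᵘ ⟦ 2 ⟧ ℚᵘ.≤ toℚᵘ ε ℚᵘ.* toℚᵘ ⟦ 4 ℕ.* suc d ⟧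
    ≤ᵘ rewrite toℚᵘ-⟦⟧ 2 | toℚᵘ-⟦⟧ (4 ℕ.* suc d) =
      ℚᵘ.*≤* (+≤+ (subst₂ ℕ._≤_ (cong (λ z → 2 ℕ.* suc z) (sym (ℕ.*-identityʳ d)))
                                (sym (ℕ.*-identityʳ (suc p ℕ.* (4 ℕ.* suc d))))
                                (ℕ.≤-trans (ℕ.*-monoˡ-≤ (suc d) {2} {4} (s≤s (s≤s z≤n)))
                                           (ℕ.m≤n*m (4 ℕ.* suc d) (suc p)))))
  scale-for (mkℚ +0 _ _) (ℚ.*<* (ℤ.+<+ ()))
  scale-for (mkℚ -[1+ _ ] _ _) (ℚ.*<* ())

  reciprocal-bound : ∀ {m} → 1 ℕ.≤ m → Σ ℚ λ ε₀ → 0ℚ < ε₀ × (∀ {ε′} → ε′ ≤ ε₀ → ⟦ m ⟧ * ε′ ≤ 1ℚ)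
  reciprocal-bound {m} 1≤m =
    1/ ⟦ m ⟧ ,
    ℚ.positive⁻¹ (1/ ⟦ m ⟧) {{ℚ.1/pos⇒pos ⟦ m ⟧ {{⟦⟧-positive 1≤m}}}} ,
    λ ε′≤ → ℚ.≤-trans (⟦⟧-*-monoˡ-≤ m ε′≤) (ℚ.≤-reflexive (ℚ.*-inverseʳ ⟦ m ⟧))
    where
    instance
      ⟦m⟧≢0 : NonZero ⟦ m ⟧
      ⟦m⟧≢0 = ℚ.pos⇒nonZero ⟦ m ⟧ {{⟦⟧-positive 1≤m}}

module AlmostComplete where

  open Counting
  open ArcCounting
  open NearHalf
  open import Data.Bool using (not)
  open import Data.Nat using (ℕ; _+_; _*_; _≤_; z≤n; s≤s)
  open import Data.Nat.Properties using (≤-trans; +-comm)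
  open import Data.Product using (_×_; _,_; proj₁; proj₂)
  open import Function using (_∘_)
  open import Relation.Binary.PropositionalEquality

  out-neighbourhood-bounds : ∀ {m} (G : Digraph) (X Y : VSet G) → 4 ≤ m →
    (∀ x → order G ≤ 2 * outdeg G x) → m * m * e⁺ G X Y ≤ order G * order G →
    AtLeastHalf m (order G) (count X) → AtLeastHalf m (order G) (count Y) →
    m * nonArcs G X (not ∘ Y) ≤ 2 * (order G * order G) × AtMostHalf m (order G) (count Y)
  out-neighbourhood-bounds {m} G X Y 4≤m deg sparse X≥ Y≥ =
      few-nonArcs m (≤-trans (s≤s z≤n) 4≤m) (count-≤ X) (atMostHalf-complement m ∁Y+Y≡n Y≥) bound
    , atMostHalf-complement m (count-complement Y)
        (atLeastHalf-from-degree m (atLeastHalf⇒≤m* m 4≤m X≥) bound)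
    where
    n : ℕ
    n = order G
    bound : DegreeBound m n (count X) (count (not ∘ Y)) (nonArcs G X (not ∘ Y))
    bound = degreeBound m (half-outdegree⇒nonArcs-bound G X Y deg) sparse
    ∁Y+Y≡n : count (not ∘ Y) + count Y ≡ order G
    ∁Y+Y≡n = trans (+-comm (count (not ∘ Y)) (count Y)) (count-complement Y)

  record AlmostCompleteSplit (m : ℕ) (D : Digraph) (U₁ U₂ : VSet D) : Set where
    field
      U₁-lower : AtLeastHalf m (order D) (count U₁)
      U₁-upper : AtMostHalf m (order D) (count U₁)
      U₂-lower : AtLeastHalf m (order D) (count U₂)
      U₂-upper : AtMostHalf m (order D) (count U₂)
      U₁⇒∁U₂ : m * nonArcs D U₁ (not ∘ U₂) ≤ 2 * (order D * order D)
      ∁U₁⇒U₂ : m * nonArcs D (not ∘ U₁) U₂ ≤ 2 * (order D * order D)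

  almostCompleteSplit : ∀ {m} (D : Digraph) (U₁ U₂ : VSet D) → 4 ≤ m →
    (∀ x → order D ≤ 2 * outdeg D x) → (∀ x → order D ≤ 2 * indeg D x) →
    m * m * e⁺ D U₁ U₂ ≤ order D * order D →
    AtLeastHalf m (order D) (count U₁) → AtLeastHalf m (order D) (count U₂) →
    AlmostCompleteSplit m D U₁ U₂
  almostCompleteSplit {m} D U₁ U₂ 4≤m out-deg in-deg sparse U₁≥ U₂≥ = record
    { U₁-lower = U₁≥
    ; U₁-upper = proj₂ backward
    ; U₂-lower = U₂≥
    ; U₂-upper = proj₂ forward
    ; U₁⇒∁U₂   = proj₁ forward
    ; ∁U₁⇒U₂   = subst (λ k → m * k ≤ 2 * (n * n)) (nonArcs-reverse D U₂ (not ∘ U₁)) (proj₁ backward)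
    }
    where
    n : ℕ
    n = order D
    forward : m * nonArcs D U₁ (not ∘ U₂) ≤ 2 * (n * n) × AtMostHalf m n (count U₂)
    forward = out-neighbourhood-bounds D U₁ U₂ 4≤m out-deg sparse U₁≥ U₂≥
    backward : m * nonArcs (reverse D) U₂ (not ∘ U₁) ≤ 2 * (n * n) × AtMostHalf m n (count U₁)
    backward = out-neighbourhood-bounds (reverse D) U₂ U₁ 4≤m in-deg
                 (subst (λ e → m * m * e ≤ n * n) (sym (e⁺-reverse D U₂ U₁)) sparse) U₂≥ U₁≥

module Cells where

  open import Data.Bool using (Bool; true; false; _∧_; not; if_then_else_)
  open import Data.Fin using (Fin; _≟_)
  open import Data.Fin.Patterns using (0F; 1F; 2F; 3F)
  open import Relation.Nullary.Decidable using (⌊_⌋)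
  open import Relation.Binary.PropositionalEquality using (_≡_; refl)

  cell : Bool → Bool → Fin 4
  cell true  false = 0F
  cell false false = 1F
  cell false true  = 2F
  cell true  true  = 3F

  in₁ in₂ : Fin 4 → Bool
  in₁ 0F = true
  in₁ 1F = false
  in₁ 2F = false
  in₁ 3F = true
  in₂ 0F = false
  in₂ 1F = false
  in₂ 2F = true
  in₂ 3F = true

  signed : Bool → Bool → Bool
  signed s b = if s then b else not b

  cell≟ : ∀ b₁ b₂ i → ⌊ cell b₁ b₂ ≟ i ⌋ ≡ signed (in₁ i) b₁ ∧ signed (in₂ i) b₂
  cell≟ true  false 0F = refl
  cell≟ true  false 1F = refl
  cell≟ true  false 2F = refl
  cell≟ true  false 3F = refl
  cell≟ false false 0F = refl
  cell≟ false false 1F = refl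
  cell≟ false false 2F = refl
  cell≟ false false 3F = refl
  cell≟ false true  0F = refl
  cell≟ false true  1F = refl
  cell≟ false true  2F = refl
  cell≟ false true  3F = refl
  cell≟ true  true  0F = refl
  cell≟ true  true  1F = refl
  cell≟ true  true  2F = refl
  cell≟ true  true  3F = refl

module Partition (D : Digraph) (U₁ U₂ : VSet D) where

  open Counting
  open Cells
  open import Data.Bool using (T; not; _∧_)
  open import Data.Bool.Properties using (T-∧; ∧-comm)
  open import Data.Fin using (Fin; _≟_)
  open import Data.Fin.Patterns using (0F; 1F; 2F; 3F)
  open import Data.Nat using (_+_)
  open import Data.Nat.Properties using (+-comm)
  open import Data.Product using (proj₁; proj₂)
  open import Function using (_∘_; Equivalence)
  open import Relation.Nullary.Decidable using (⌊_⌋)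
  open import Relation.Binary.PropositionalEquality

  part : Fin (order D) → Fin 4
  part x = cell (U₁ x) (U₂ x)

  -- W i is the paper's W_{i+1}.
  W : Fin 4 → VSet D
  W i x = ⌊ part x ≟ i ⌋

  W-signs : ∀ i x → W i x ≡ signed (in₁ i) (U₁ x) ∧ signed (in₂ i) (U₂ x)
  W-signs i x = cell≟ (U₁ x) (U₂ x) i

  W⊆₁ : ∀ i x → T (W i x) → T (signed (in₁ i) (U₁ x))
  W⊆₁ i x = proj₁ ∘ Equivalence.to T-∧ ∘ subst T (W-signs i x)

  W⊆₂ : ∀ i x → T (W i x) → T (signed (in₂ i) (U₂ x))
  W⊆₂ i x = proj₂ ∘ Equivalence.to T-∧ ∘ subst T (W-signs i x)

  W₄+W₁≡U₁ : count (W 3F) + count (W 0F) ≡ count U₁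
  W₄+W₁≡U₁ = trans (cong₂ _+_ (count-cong (W-signs 3F)) (count-cong (W-signs 0F)))
                   (sym (count-split U₁ U₂))

  W₄+W₃≡U₂ : count (W 3F) + count (W 2F) ≡ count U₂
  W₄+W₃≡U₂ = trans (cong₂ _+_ (count-cong (λ x → trans (W-signs 3F x) (∧-comm (U₁ x) (U₂ x))))
                              (count-cong (λ x → trans (W-signs 2F x) (∧-comm (not (U₁ x)) (U₂ x)))))
                   (sym (count-split U₂ U₁))

  W₃+W₂≡∁U₁ : count (W 2F) + count (W 1F) ≡ count (not ∘ U₁)
  W₃+W₂≡∁U₁ = trans (cong₂ _+_ (count-cong (W-signs 2F)) (count-cong (W-signs 1F)))
                    (sym (count-split (not ∘ U₁) U₂))

  W₃+W₄≡U₂ : count (W 2F) + count (W 3F) ≡ count U₂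
  W₃+W₄≡U₂ = trans (+-comm (count (W 2F)) (count (W 3F))) W₄+W₃≡U₂

module Extremal where

  open Counting
  open ArcCounting
  open NearHalf
  open RationalBridge
  open AlmostComplete
  open Cells
  open import Data.Bool using (T; not)
  open import Data.Fin.Patterns using (0F; 1F; 2F; 3F)
  open import Data.Nat as ℕ using (ℕ; z≤n; s≤s)
  import Data.Nat.Properties as ℕ
  open import Data.Product using (_,_; proj₁; proj₂)
  open import Data.Rational using (ℚ; 0ℚ; 1ℚ; _≤_; _+_; _*_; _-_; ½)
  open import Function using (_∘_)
  open import Relation.Binary.PropositionalEquality using (_≡_; trans)

  ec1-from-split : ∀ m ε (D : Digraph) (U₁ U₂ : VSet D) → 1 ℕ.≤ m → ⟦ 2 ⟧ ≤ ε * ⟦ m ⟧ →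
    AlmostCompleteSplit m D U₁ U₂ → EC1 D ε
  ec1-from-split m ε D U₁ U₂ 1≤m 2≤εm split =
    part ,
    close-to-ℚ m ε n (count (W 0F)) (count (W 2F)) 1≤m 2≤εm
      (close-by-common-part m {n = n} W₄+W₁≡U₁ W₄+W₃≡U₂ U₁-upper U₂-lower)
      (close-by-common-part m {n = n} W₄+W₃≡U₂ W₄+W₁≡U₁ U₂-upper U₁-lower) ,
    close-to-ℚ m ε n (count (W 1F)) (count (W 3F)) 1≤m 2≤εm
      (close-by-common-part m {n = n} W₃+W₂≡∁U₁ W₃+W₄≡U₂ ∁U₁-upper U₂-lower)
      (close-by-common-part m {n = n} W₃+W₄≡U₂ W₃+W₂≡∁U₁ U₂-upper ∁U₁-lower) ,
    dense₁ (W⊆₁ 0F) (W⊆₂ 1F) , dense₂ (W⊆₁ 1F) (W⊆₂ 2F) ,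
    dense₂ (W⊆₁ 2F) (W⊆₂ 3F) , dense₁ (W⊆₁ 3F) (W⊆₂ 0F) ,
    dense₁ (W⊆₁ 0F) (W⊆₂ 0F) , dense₂ (W⊆₁ 2F) (W⊆₂ 2F) ,
    dense₂ (W⊆₁ 1F) (W⊆₂ 3F) , dense₁ (W⊆₁ 3F) (W⊆₂ 1F)
    where
    open AlmostCompleteSplit split
    open Partition D U₁ U₂
    n : ℕ
    n = order D

    ∁U₁+U₁≡n : count (not ∘ U₁) ℕ.+ count U₁ ≡ n
    ∁U₁+U₁≡n = trans (ℕ.+-comm (count (not ∘ U₁)) (count U₁)) (count-complement U₁)
    ∁U₁-upper : AtMostHalf m n (count (not ∘ U₁))
    ∁U₁-upper = atMostHalf-complement m ∁U₁+U₁≡n U₁-lower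
    ∁U₁-lower : AtLeastHalf m n (count (not ∘ U₁))
    ∁U₁-lower = atLeastHalf-complement m ∁U₁+U₁≡n U₁-upper

    dense₁ : ∀ {P Q : VSet D} → (∀ x → T (P x) → T (U₁ x)) → (∀ y → T (Q y) → T (not (U₂ y))) →
             ⟦ count P ⟧ * ⟦ count Q ⟧ - ε * (⟦ n ⟧ * ⟦ n ⟧) ≤ ⟦ e⁺ D P Q ⟧
    dense₁ {P} {Q} P⊆U₁ Q⊆∁U₂ = dense-to-ℚ m ε n (count P) (count Q) (e⁺ D P Q) 1≤m 2≤εm
      (count*count≤e⁺+nonArcs D P⊆U₁ Q⊆∁U₂) U₁⇒∁U₂

    dense₂ : ∀ {P Q : VSet D} → (∀ x → T (P x) → T (not (U₁ x))) → (∀ y → T (Q y) → T (U₂ y)) →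
             ⟦ count P ⟧ * ⟦ count Q ⟧ - ε * (⟦ n ⟧ * ⟦ n ⟧) ≤ ⟦ e⁺ D P Q ⟧
    dense₂ {P} {Q} P⊆∁U₁ Q⊆U₂ = dense-to-ℚ m ε n (count P) (count Q) (e⁺ D P Q) 1≤m 2≤εm
      (count*count≤e⁺+nonArcs D P⊆∁U₁ Q⊆U₂) ∁U₁⇒U₂

  ec⇒ec1 : ∀ m ε ε′ k (D : Digraph) → 4 ℕ.≤ m → ⟦ 2 ⟧ ≤ ε * ⟦ m ⟧ →
    0ℚ ≤ ε′ → ⟦ m ⟧ * ε′ ≤ 1ℚ →
    δ⁰≥ D (½ * ⟦ order D ⟧ + ⟦ k ⟧) → EC D ε′ → EC1 D ε
  ec⇒ec1 m ε ε′ k D 4≤m 2≤εm 0≤ε′ mε′≤1 δ⁰ (U₁ , U₂ , U₁≥ , U₂≥ , sparse) =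
    ec1-from-split m ε D U₁ U₂ (ℕ.≤-trans (s≤s z≤n) 4≤m) 2≤εm
      (almostCompleteSplit D U₁ U₂ 4≤m
        (λ x → ½n+k≤d⇒n≤2d n k (outdeg D x) (proj₁ (δ⁰ x)))
        (λ x → ½n+k≤d⇒n≤2d n k (indeg D x) (proj₂ (δ⁰ x)))
        (sparse-from-ℚ m n (e⁺ D U₁ U₂) ε′ 0≤ε′ mε′≤1 sparse)
        (atLeastHalf-from-ℚ m n (count U₁) ε′ mε′≤1 U₁≥)
        (atLeastHalf-from-ℚ m n (count U₂) ε′ mε′≤1 U₂≥))
    where
    n : ℕ
    n = order D

open import Data.Nat using (ℕ; _*_; _≥_; z≤n; s≤s)
open import Data.Nat.Properties using (≤-trans)
open import Data.Rational using (ℚ; 0ℚ; _<_; _≤_; ½) renaming (_+_ to _+ℚ_; _*_ to _*ℚ_)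
open import Data.Rational.Properties using (<⇒≤)
open import Data.Product using (Σ; _×_; _,_)
open RationalBridge using (scale-for; reciprocal-bound)
open Extremal using (ec⇒ec1)

lemma3p14 : (ε : ℚ) → 0ℚ < ε →
    Σ ℚ λ ε₀ → (0ℚ < ε₀) × ((ε' : ℚ) → 0ℚ < ε' → ε' ≤ ε₀ →
      Σ ℕ λ C₀ → (C : ℕ) → C ≥ C₀ →
        (H D : Digraph) → NoIsolated H →
        order D ≥ C * arcs H →
        δ⁰≥ D (½ *ℚ ⟦ order D ⟧ +ℚ ⟦ arcs H ⟧) →
        EC D ε' →
        EC1 D ε)
lemma3p14 ε 0<ε =
  let m , 4≤m , 2≤εm = scale-for ε 0<ε
      ε₀ , 0<ε₀ , ≤ε₀⇒m*≤1 = reciprocal-bound (≤-trans (s≤s z≤n) 4≤m)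
  in  ε₀ , 0<ε₀ , λ ε′ 0<ε′ ε′≤ε₀ →
        0 , λ C _ H D _ _ δ⁰ ec →
          ec⇒ec1 m ε ε′ (arcs H) D 4≤m 2≤εm (<⇒≤ 0<ε′) (≤ε₀⇒m*≤1 ε′≤ε₀) δ⁰ ec
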